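{- Let $\psi$ be an arrow-free type, $\alpha$ a continuation variable and $r$ a term. If $r\in[\![\psi]\!]$, then $\mathtt{catch}\,\alpha\,r\in[\![\psi]\!]$.
   Context: Calculus $\lambda^{::}_{\mathtt{catch}}$. Types: $\sigma,\tau,\rho ::= \mathtt{unit} \mid \mathtt{list}\,\tau \mid \sigma\to\tau$; a type is arrow-free if it contains no $\to$. Terms: $t,r,s ::= x \mid () \mid \mathtt{nil} \mid (::) \mid \mathtt{lrec} \mid \lambda x.r \mid t\,s \mid \mathtt{catch}\,\alpha\,t \mid \mathtt{throw}\,\alpha\,t$ ($x$ variables, $\alpha,\beta$ continuation variables; $\mathtt{catch}\,\alpha$ binds $\alpha$; application left-associative; $t::r$ abbreviates $(::)\,t\,r$). $\mathrm{FCV}$ = free continuation variables, $t[x:=r]$ capture-avoiding substitution. Values: $v,w ::= x \mid () \mid \mathtt{nil} \mid (::) \mid (::)\,v \mid (::)\,v\,w \mid \mathtt{lrec} \mid \mathtt{lrec}\,v \mid \mathtt{lrec}\,v\,w \mid \lambda x.r$. Contexts $E ::= \Box\,t \mid v\,\Box \mid \mathtt{throw}\,\alpha\,\Box$. Reduction $\to$ is the compatible closure of: $(\lambda x.t)\,v\to t[x:=v]$; $E[\mathtt{throw}\,\alpha\,t]\to\mathtt{throw}\,\alpha\,t$; $\mathtt{catch}\,\alpha\,(\mathtt{throw}\,\alpha\,t)\to\mathtt{catch}\,\alpha\,t$; $\mathtt{catch}\,\alpha\,(\mathtt{throw}\,\beta\,v)\to\mathtt{throw}\,\beta\,v$ if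 $\alpha\notin\{\beta\}\cup\mathrm{FCV}(v)$; $\mathtt{catch}\,\alpha\,v\to v$ if $\alpha\notin\mathrm{FCV}(v)$; $\mathtt{lrec}\,v_r\,v_s\,\mathtt{nil}\to v_r$; $\mathtt{lrec}\,v_r\,v_s\,(v_h::v_t)\to v_s\,v_h\,v_t\,(\mathtt{lrec}\,v_r\,v_s\,v_t)$; $\twoheadrightarrow$ is its reflexive-transitive closure. $\mathrm{SN}$ is the set of terms $t$ for which the lengths of all reduction sequences starting at $t$ are bounded. For a set of terms $S$, $L(S)$ is inductively defined by: $t\in L(S)$ if for all values $v,w$ with $t\twoheadrightarrow v::w$ we have $v\in S$ and $w\in L(S)$. Interpretation: $[\![\mathtt{unit}]\!]=\mathrm{SN}$, $[\![\mathtt{list}\,\sigma]\!]=\mathrm{SN}\cap L([\![\sigma]\!])$, $[\![\sigma\to\tau]\!]=\{t\mid \forall s\in[\![\sigma]\!],\ ts\in[\![\tau]\!]\}$. -}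

module Defs where

open import Data.Nat using (ℕ; zero; suc; _≤_)
open import Data.Product using (Σ; _×_)
open import Relation.Binary.Construct.Closure.ReflexiveTransitive using (Star)

data Ty : Set where
  unit : Ty
  list : Ty → Ty
  _⇒_  : Ty → Ty → Ty

data ArrowFree : Ty → Set where
  af-unit : ArrowFree unit
  af-list : ∀ {τ} → ArrowFree τ → ArrowFree (list τ)

-- Terms (de Bruijn indices for term variables and, separately, for
-- continuation variables; `catch t` binds continuation variable 0 in t).

data Tm : Set where
  var   : ℕ → Tm
  ⋆     : Tm
  nil   : Tm
  cons  : Tm
  lrec  : Tm
  lam   : Tm → Tm
  app   : Tm → Tm → Tm
  catch : Tm → Tm
  throw : ℕ → Tm → Tm

_∷ₜ_ : Tm → Tm → Tm
t ∷ₜ r = app (app cons t) r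

ext : (ℕ → ℕ) → ℕ → ℕ
ext ρ zero    = zero
ext ρ (suc n) = suc (ρ n)

ren : (ℕ → ℕ) → Tm → Tm
ren ρ (var x)     = var (ρ x)
ren ρ ⋆           = ⋆
ren ρ nil         = nil
ren ρ cons        = cons
ren ρ lrec        = lrec
ren ρ (lam t)     = lam (ren (ext ρ) t)
ren ρ (app t s)   = app (ren ρ t) (ren ρ s)
ren ρ (catch t)   = catch (ren ρ t)
ren ρ (throw k t) = throw k (ren ρ t)

cren : (ℕ → ℕ) → Tm → Tm
cren ρ (var x)     = var x
cren ρ ⋆           = ⋆
cren ρ nil         = nil
cren ρ cons        = cons
cren ρ lrec        = lrec
cren ρ (lam t)     = lam (cren ρ t)
cren ρ (app t s)   = app (cren ρ t) (cren ρ s)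
cren ρ (catch t)   = catch (cren (ext ρ) t)
cren ρ (throw k t) = throw (ρ k) (cren ρ t)

cweaken : Tm → Tm
cweaken = cren suc

exts : (ℕ → Tm) → ℕ → Tm
exts σ zero    = var zero
exts σ (suc n) = ren suc (σ n)

sub : (ℕ → Tm) → Tm → Tm
sub σ (var x)     = σ x
sub σ ⋆           = ⋆
sub σ nil         = nil
sub σ cons        = cons
sub σ lrec        = lrec
sub σ (lam t)     = lam (sub (exts σ) t)
sub σ (app t s)   = app (sub σ t) (sub σ s)
sub σ (catch t)   = catch (sub (λ n → cweaken (σ n)) t)
sub σ (throw k t) = throw k (sub σ t)

single : Tm → ℕ → Tm
single v zero    = v
single v (suc n) = var n

_[_] : Tm → Tm → Tm
t [ v ] = sub (single v) t

data Value : Tm → Set where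
  v-var    : ∀ {x} → Value (var x)
  v-unit   : Value ⋆
  v-nil    : Value nil
  v-cons0  : Value cons
  v-cons1  : ∀ {v} → Value v → Value (app cons v)
  v-cons2  : ∀ {v w} → Value v → Value w → Value (app (app cons v) w)
  v-lrec0  : Value lrec
  v-lrec1  : ∀ {v} → Value v → Value (app lrec v)
  v-lrec2  : ∀ {v w} → Value v → Value w → Value (app (app lrec v) w)
  v-lam    : ∀ {r} → Value (lam r)

infix 4 _⟶_
data _⟶_ : Tm → Tm → Set where
  β        : ∀ {t v} → Value v → app (lam t) v ⟶ t [ v ]
  throw-appL : ∀ {k t s} → app (throw k t) s ⟶ throw k t
  throw-appR : ∀ {v k t} → Value v → app v (throw k t) ⟶ throw k t
  throw-throw : ∀ {j k t} → throw j (throw k t) ⟶ throw k t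
  catch-throw-same : ∀ {t} → catch (throw zero t) ⟶ catch t
  -- catch α (throw β v) → throw β v, α ∉ {β} ∪ FCV(v)
  catch-throw-other : ∀ {k v} → Value (cweaken v) →
    catch (throw (suc k) (cweaken v)) ⟶ throw k v
  -- catch α v → v, α ∉ FCV(v)
  catch-val : ∀ {v} → Value (cweaken v) → catch (cweaken v) ⟶ v
  lrec-nil  : ∀ {vr vs} → Value vr → Value vs →
    app (app (app lrec vr) vs) nil ⟶ vr
  lrec-cons : ∀ {vr vs vh vt} → Value vr → Value vs → Value vh → Value vt →
    app (app (app lrec vr) vs) (vh ∷ₜ vt)
      ⟶ app (app (app vs vh) vt) (app (app (app lrec vr) vs) vt)
  ξ-lam   : ∀ {t t'} → t ⟶ t' → lam t ⟶ lam t'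
  ξ-appL  : ∀ {t t' s} → t ⟶ t' → app t s ⟶ app t' s
  ξ-appR  : ∀ {t s s'} → s ⟶ s' → app t s ⟶ app t s'
  ξ-catch : ∀ {t t'} → t ⟶ t' → catch t ⟶ catch t'
  ξ-throw : ∀ {k t t'} → t ⟶ t' → throw k t ⟶ throw k t'

infix 4 _↠_
_↠_ : Tm → Tm → Set
_↠_ = Star _⟶_

data _⟶[_]_ : Tm → ℕ → Tm → Set where
  done : ∀ {t} → t ⟶[ zero ] t
  step : ∀ {t u w n} → t ⟶ u → u ⟶[ n ] w → t ⟶[ suc n ] w

SN : Tm → Set
SN t = Σ ℕ λ n → ∀ {k u} → t ⟶[ k ] u → k ≤ n

data L (S : Tm → Set) (t : Tm) : Set where
  mkL : (∀ {v w} → Value v → Value w → t ↠ (v ∷ₜ w) → S v × L S w) → L S t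

⟦_⟧ : Ty → Tm → Set
⟦ unit ⟧ t    = SN t
⟦ list σ ⟧ t  = SN t × L ⟦ σ ⟧ t
⟦ σ ⇒ τ ⟧ t   = ∀ s → ⟦ σ ⟧ s → ⟦ τ ⟧ (app t s)

-- For an arrow-free type ψ, membership in ⟦ ψ ⟧ is just strong normalisation: a term
-- whose reductions are bounded by n can only reach v ∷ w with v and w bounded by n as
-- well, so induction on the bound (and on the term, for the tail w) gives membership in
-- L. It therefore suffices that catch preserves SN. If every reduction sequence of r has
-- length ≤ n, every one of catch r has length ≤ 2n + 2: steps under catch use up the
-- budget of r; an exit step (catch α v → v, catch α (throw β v) → throw β v) leaves a
-- term whose reductions lift back along continuation weakening, so it has budget n; and
-- catch α (throw α t) → catch α t either strips a throw that t itself could have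
-- absorbed by throw-throw, or leaves a t that is not a throw, so that the next step is
-- again an inner or an exit step.

module Submission where

open import Defs
open import Data.Nat using (ℕ; zero; suc; _*_; _≤_; z≤n; s≤s)
open import Data.Nat.Properties using (≤-trans; m≤n⇒m≤1+n; m≤m*n)
open import Data.Product using (_×_; _,_; proj₁)
open import Data.Empty using (⊥; ⊥-elim)
open import Data.Unit using (⊤; tt)
open import Function using (_∘_)
open import Relation.Binary.Construct.Closure.ReflexiveTransitive using (ε; _◅_)
open import Relation.Binary.PropositionalEquality
  using (_≡_; _≗_; refl; sym; trans; cong; cong₂; subst)

ext-cong : ∀ {ρ ρ'} → ρ ≗ ρ' → ext ρ ≗ ext ρ'
ext-cong eq zero    = refl
ext-cong eq (suc n) = cong suc (eq n)

ext-∘ : ∀ ρ ρ' → ext ρ ∘ ext ρ' ≗ ext (ρ ∘ ρ')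
ext-∘ ρ ρ' zero    = refl
ext-∘ ρ ρ' (suc n) = refl

cren-cong : ∀ {ρ ρ'} → ρ ≗ ρ' → cren ρ ≗ cren ρ'
cren-cong eq (var x)     = refl
cren-cong eq ⋆           = refl
cren-cong eq nil         = refl
cren-cong eq cons        = refl
cren-cong eq lrec        = refl
cren-cong eq (lam t)     = cong lam (cren-cong eq t)
cren-cong eq (app t s)   = cong₂ app (cren-cong eq t) (cren-cong eq s)
cren-cong eq (catch t)   = cong catch (cren-cong (ext-cong eq) t)
cren-cong eq (throw k t) = cong₂ throw (eq k) (cren-cong eq t)

cren-∘ : ∀ ρ ρ' → cren ρ ∘ cren ρ' ≗ cren (ρ ∘ ρ')
cren-∘ ρ ρ' (var x)     = refl
cren-∘ ρ ρ' ⋆           = refl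
cren-∘ ρ ρ' nil         = refl
cren-∘ ρ ρ' cons        = refl
cren-∘ ρ ρ' lrec        = refl
cren-∘ ρ ρ' (lam t)     = cong lam (cren-∘ ρ ρ' t)
cren-∘ ρ ρ' (app t s)   = cong₂ app (cren-∘ ρ ρ' t) (cren-∘ ρ ρ' s)
cren-∘ ρ ρ' (catch t)   =
  cong catch (trans (cren-∘ (ext ρ) (ext ρ') t) (cren-cong (ext-∘ ρ ρ') t))
cren-∘ ρ ρ' (throw k t) = cong (throw (ρ (ρ' k))) (cren-∘ ρ ρ' t)

cren-ext-cweaken : ∀ ρ → cren (ext ρ) ∘ cweaken ≗ cweaken ∘ cren ρ
cren-ext-cweaken ρ t = trans (cren-∘ (ext ρ) suc t) (sym (cren-∘ suc ρ t))

cren-ren : ∀ ρ ρ' → cren ρ ∘ ren ρ' ≗ ren ρ' ∘ cren ρ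
cren-ren ρ ρ' (var x)     = refl
cren-ren ρ ρ' ⋆           = refl
cren-ren ρ ρ' nil         = refl
cren-ren ρ ρ' cons        = refl
cren-ren ρ ρ' lrec        = refl
cren-ren ρ ρ' (lam t)     = cong lam (cren-ren ρ (ext ρ') t)
cren-ren ρ ρ' (app t s)   = cong₂ app (cren-ren ρ ρ' t) (cren-ren ρ ρ' s)
cren-ren ρ ρ' (catch t)   = cong catch (cren-ren (ext ρ) ρ' t)
cren-ren ρ ρ' (throw k t) = cong (throw (ρ k)) (cren-ren ρ ρ' t)

exts-cong : ∀ {σ σ'} → σ ≗ σ' → exts σ ≗ exts σ'
exts-cong eq zero    = refl
exts-cong eq (suc n) = cong (ren suc) (eq n)

sub-cong : ∀ {σ σ'} → σ ≗ σ' → sub σ ≗ sub σ'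
sub-cong eq (var x)     = eq x
sub-cong eq ⋆           = refl
sub-cong eq nil         = refl
sub-cong eq cons        = refl
sub-cong eq lrec        = refl
sub-cong eq (lam t)     = cong lam (sub-cong (exts-cong eq) t)
sub-cong eq (app t s)   = cong₂ app (sub-cong eq t) (sub-cong eq s)
sub-cong eq (catch t)   = cong catch (sub-cong (cong cweaken ∘ eq) t)
sub-cong eq (throw k t) = cong (throw k) (sub-cong eq t)

cren-sub : ∀ ρ σ → cren ρ ∘ sub σ ≗ sub (cren ρ ∘ σ) ∘ cren ρ
cren-sub ρ σ (var x)     = refl
cren-sub ρ σ ⋆           = refl
cren-sub ρ σ nil         = refl
cren-sub ρ σ cons        = refl
cren-sub ρ σ lrec        = refl
cren-sub ρ σ (lam t)     =
  cong lam (trans (cren-sub ρ (exts σ) t) (sub-cong cren-exts (cren ρ t)))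
  where
  cren-exts : cren ρ ∘ exts σ ≗ exts (cren ρ ∘ σ)
  cren-exts zero    = refl
  cren-exts (suc n) = cren-ren ρ suc (σ n)
cren-sub ρ σ (app t s)   = cong₂ app (cren-sub ρ σ t) (cren-sub ρ σ s)
cren-sub ρ σ (catch t)   =
  cong catch (trans (cren-sub (ext ρ) (cweaken ∘ σ) t)
                    (sub-cong (cren-ext-cweaken ρ ∘ σ) (cren (ext ρ) t)))
cren-sub ρ σ (throw k t) = cong (throw (ρ k)) (cren-sub ρ σ t)

cren-[] : ∀ ρ t v → cren ρ (t [ v ]) ≡ cren ρ t [ cren ρ v ]
cren-[] ρ t v = trans (cren-sub ρ (single v) t) (sub-cong cren-single (cren ρ t))
  where
  cren-single : cren ρ ∘ single v ≗ single (cren ρ v)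
  cren-single zero    = refl
  cren-single (suc n) = refl

cren-Value : ∀ ρ {v} → Value v → Value (cren ρ v)
cren-Value ρ v-var         = v-var
cren-Value ρ v-unit        = v-unit
cren-Value ρ v-nil         = v-nil
cren-Value ρ v-cons0       = v-cons0
cren-Value ρ (v-cons1 v)   = v-cons1 (cren-Value ρ v)
cren-Value ρ (v-cons2 v w) = v-cons2 (cren-Value ρ v) (cren-Value ρ w)
cren-Value ρ v-lrec0       = v-lrec0
cren-Value ρ (v-lrec1 v)   = v-lrec1 (cren-Value ρ v)
cren-Value ρ (v-lrec2 v w) = v-lrec2 (cren-Value ρ v) (cren-Value ρ w)
cren-Value ρ v-lam         = v-lam

cren-⟶ : ∀ ρ {t t'} → t ⟶ t' → cren ρ t ⟶ cren ρ t'
cren-⟶ ρ (β {t} {v} val) =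
  subst (cren ρ (app (lam t) v) ⟶_) (sym (cren-[] ρ t v)) (β (cren-Value ρ val))
cren-⟶ ρ throw-appL         = throw-appL
cren-⟶ ρ (throw-appR val)   = throw-appR (cren-Value ρ val)
cren-⟶ ρ throw-throw        = throw-throw
cren-⟶ ρ catch-throw-same   = catch-throw-same
cren-⟶ ρ (catch-throw-other {k} {v} val)
  rewrite cren-ext-cweaken ρ v
  = catch-throw-other (subst Value (cren-ext-cweaken ρ v) (cren-Value (ext ρ) val))
cren-⟶ ρ (catch-val {v} val)
  rewrite cren-ext-cweaken ρ v
  = catch-val (subst Value (cren-ext-cweaken ρ v) (cren-Value (ext ρ) val))
cren-⟶ ρ (lrec-nil a b)     = lrec-nil (cren-Value ρ a) (cren-Value ρ b)
cren-⟶ ρ (lrec-cons a b c d) =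
  lrec-cons (cren-Value ρ a) (cren-Value ρ b) (cren-Value ρ c) (cren-Value ρ d)
cren-⟶ ρ (ξ-lam r)          = ξ-lam (cren-⟶ ρ r)
cren-⟶ ρ (ξ-appL r)         = ξ-appL (cren-⟶ ρ r)
cren-⟶ ρ (ξ-appR r)         = ξ-appR (cren-⟶ ρ r)
cren-⟶ ρ (ξ-catch r)        = ξ-catch (cren-⟶ (ext ρ) r)
cren-⟶ ρ (ξ-throw r)        = ξ-throw (cren-⟶ ρ r)

Bounded : ℕ → Tm → Set
Bounded n t = ∀ {k u} → t ⟶[ k ] u → k ≤ n

⟶[]-map : (f : Tm → Tm) → (∀ {t t'} → t ⟶ t' → f t ⟶ f t') →
          ∀ {k t u} → t ⟶[ k ] u → f t ⟶[ k ] f u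
⟶[]-map f f-⟶ done       = done
⟶[]-map f f-⟶ (step r rs) = step (f-⟶ r) (⟶[]-map f f-⟶ rs)

Bounded-reflect : (f : Tm → Tm) → (∀ {t t'} → t ⟶ t' → f t ⟶ f t') →
                  ∀ {n t} → Bounded n (f t) → Bounded n t
Bounded-reflect f f-⟶ bd rs = bd (⟶[]-map f f-⟶ rs)

Bounded-cweaken : ∀ {n t} → Bounded n (cweaken t) → Bounded n t
Bounded-cweaken = Bounded-reflect cweaken (cren-⟶ suc)

Bounded-⟶ : ∀ {n t t'} → Bounded (suc n) t → t ⟶ t' → Bounded n t'
Bounded-⟶ bd r rs with bd (step r rs)
... | s≤s k≤n = k≤n

Bounded-zero-normal : ∀ {t t'} → Bounded zero t → t ⟶ t' → ⊥
Bounded-zero-normal bd r with bd (step r done)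
... | ()

module _ (S : Tm → Set) (SN⊆S : ∀ {t} → SN t → S t) where

  mutual
    Bounded⇒L : ∀ n t → Bounded n t → L S t
    Bounded⇒L n t bd = mkL (L-reduct n t bd)

    L-reduct : ∀ n t → Bounded n t →
               ∀ {v w} → Value v → Value w → t ↠ v ∷ₜ w → S v × L S w
    L-reduct n (app (app cons v) w) bd _ _ ε =
      SN⊆S (n , Bounded-reflect (λ x → x ∷ₜ w) (ξ-appL ∘ ξ-appR) bd) ,
      Bounded⇒L n w (Bounded-reflect (v ∷ₜ_) ξ-appR bd)
    L-reduct zero    t bd _ _ (r ◅ _) = ⊥-elim (Bounded-zero-normal bd r)
    L-reduct (suc n) t bd val-v val-w (r ◅ rs) with Bounded⇒L n _ (Bounded-⟶ bd r)
    ... | mkL reduct = reduct val-v val-w rs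

SN⇒⟦⟧ : ∀ {ψ} → ArrowFree ψ → ∀ {t} → SN t → ⟦ ψ ⟧ t
SN⇒⟦⟧ af-unit                sn       = sn
SN⇒⟦⟧ (af-list {τ} af) {t} sn@(n , bd) = sn , Bounded⇒L ⟦ τ ⟧ (SN⇒⟦⟧ af) n t bd

⟦⟧⇒SN : ∀ {ψ} → ArrowFree ψ → ∀ {t} → ⟦ ψ ⟧ t → SN t
⟦⟧⇒SN af-unit     t∈ψ = t∈ψ
⟦⟧⇒SN (af-list _) t∈ψ = proj₁ t∈ψ

NotThrow : Tm → Set
NotThrow (throw _ _) = ⊥
NotThrow _           = ⊤

data ThrowView : Tm → Set where
  is-throw  : ∀ j t → ThrowView (throw j t)
  not-throw : ∀ {t} → NotThrow t → ThrowView t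

throwView : ∀ t → ThrowView t
throwView (var _)     = not-throw tt
throwView ⋆           = not-throw tt
throwView nil         = not-throw tt
throwView cons        = not-throw tt
throwView lrec        = not-throw tt
throwView (lam _)     = not-throw tt
throwView (app _ _)   = not-throw tt
throwView (catch _)   = not-throw tt
throwView (throw j t) = is-throw j t

n≤1+n*2 : ∀ n → n ≤ suc (n * 2)
n≤1+n*2 n = m≤n⇒m≤1+n (m≤m*n n 2)

mutual
  Bounded-catch : ∀ n {t} → Bounded n t → Bounded (suc (suc (n * 2))) (catch t)
  Bounded-catch n       bd done                 = z≤n
  Bounded-catch zero    bd (step (ξ-catch r) _) = ⊥-elim (Bounded-zero-normal bd r)
  Bounded-catch (suc n) bd (step (ξ-catch r) rs) =
    s≤s (m≤n⇒m≤1+n (Bounded-catch n (Bounded-⟶ bd r) rs))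
  Bounded-catch n bd (step (catch-throw-same {t}) rs) with throwView t
  Bounded-catch zero    bd (step catch-throw-same _)  | is-throw _ _ =
    ⊥-elim (Bounded-zero-normal bd throw-throw)
  Bounded-catch (suc n) bd (step catch-throw-same rs) | is-throw _ _ =
    s≤s (m≤n⇒m≤1+n (Bounded-catch n (Bounded-⟶ bd throw-throw) rs))
  ... | not-throw t≠throw =
    s≤s (Bounded-catch-notThrow n t≠throw (Bounded-reflect (throw zero) ξ-throw bd) rs)
  Bounded-catch n bd (step (catch-throw-other {k} _) rs) =
    s≤s (≤-trans (Bounded-cweaken {t = throw k _} bd rs) (n≤1+n*2 n))
  Bounded-catch n bd (step (catch-val _) rs) =
    s≤s (≤-trans (Bounded-cweaken bd rs) (n≤1+n*2 n))

  Bounded-catch-notThrow : ∀ n {t} → NotThrow t → Bounded n t →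
                           Bounded (suc (n * 2)) (catch t)
  Bounded-catch-notThrow n       _ bd done                  = z≤n
  Bounded-catch-notThrow zero    _ bd (step (ξ-catch r) _)  = ⊥-elim (Bounded-zero-normal bd r)
  Bounded-catch-notThrow (suc n) _ bd (step (ξ-catch r) rs) =
    s≤s (Bounded-catch n (Bounded-⟶ bd r) rs)
  Bounded-catch-notThrow n () bd (step catch-throw-same _)
  Bounded-catch-notThrow n () bd (step (catch-throw-other _) _)
  Bounded-catch-notThrow n _  bd (step (catch-val _) rs) =
    s≤s (≤-trans (Bounded-cweaken bd rs) (m≤m*n n 2))

SN-catch : ∀ {t} → SN t → SN (catch t)
SN-catch (n , bd) = suc (suc (n * 2)) , Bounded-catch n bd

lemma4p15 : (ψ : Ty) → ArrowFree ψ → (r : Tm) → ⟦ ψ ⟧ r → ⟦ ψ ⟧ (catch r)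
lemma4p15 ψ af r r∈ψ = SN⇒⟦⟧ af (SN-catch (⟦⟧⇒SN af r∈ψ))
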